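{- Let $G$ be a graph, and let $G'$ be the graph obtained from $G$ by adding a new vertex adjacent to all vertices of $G$. Then $G$ is equidominating if and only if $G'$ is equidominating.
   Context: All graphs are finite, simple and undirected; $\mathbb{N}=\{1,2,\dots\}$. An mds of $G=(V,E)$ is an inclusion-minimal set $D\subseteq V$ such that every vertex is in $D$ or adjacent to a vertex of $D$. $G$ is equidominating if there exist $t\in\mathbb{N}$ and $w\colon V\to\mathbb{N}$ such that for all $D\subseteq V$: $D$ is an mds iff $\sum_{v\in D}w(v)=t$. -}

module Defs where

open import Data.Nat using (ℕ; suc; _+_; NonZero)
open import Data.Bool using (Bool; true; false)
open import Data.Fin using (Fin; zero; suc)
open import Data.Fin.Subset using (Subset; _∈_; _⊂_; _⊆_)
open import Data.Vec using (Vec; []; _∷_)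
open import Data.Product using (Σ; ∃; ∃-syntax; _×_)
open import Data.Sum using (_⊎_)
open import Relation.Nullary using (¬_)
open import Relation.Binary.PropositionalEquality using (_≡_)

record Graph (n : ℕ) : Set where
  field
    adj   : Fin n → Fin n → Bool
    sym   : ∀ u v → adj u v ≡ adj v u
    irrefl : ∀ v → adj v v ≡ false
open Graph public

Dominating : ∀ {n} → Graph n → Subset n → Set
Dominating G D = ∀ v → v ∈ D ⊎ ∃[ u ] (u ∈ D × adj G u v ≡ true)

IsMDS : ∀ {n} → Graph n → Subset n → Set
IsMDS G D = Dominating G D × (∀ D' → D' ⊂ D → ¬ Dominating G D')

weight : ∀ {n} → (Fin n → ℕ) → Subset n → ℕ
weight {.0} w [] = 0
weight {suc n} w (true ∷ D) = w zero + weight (λ i → w (suc i)) D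
weight {suc n} w (false ∷ D) = weight (λ i → w (suc i)) D

Positive : ℕ → Set
Positive k = NonZero k

Equidominating : ∀ {n} → Graph n → Set
Equidominating {n} G =
  Σ ℕ λ t → Σ (Fin n → ℕ) λ w →
    Positive t × (∀ v → Positive (w v)) ×
    (∀ (D : Subset n) → (IsMDS G D → weight w D ≡ t) × (weight w D ≡ t → IsMDS G D))

coneAdj : ∀ {n} → Graph n → Fin (suc n) → Fin (suc n) → Bool
coneAdj G zero zero = false
coneAdj G zero (suc _) = true
coneAdj G (suc _) zero = true
coneAdj G (suc u) (suc v) = adj G u v

coneSym : ∀ {n} (G : Graph n) u v → coneAdj G u v ≡ coneAdj G v u
coneSym G zero zero = Relation.Binary.PropositionalEquality.refl
coneSym G zero (suc v) = Relation.Binary.PropositionalEquality.refl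
coneSym G (suc u) zero = Relation.Binary.PropositionalEquality.refl
coneSym G (suc u) (suc v) = sym G u v

coneIrrefl : ∀ {n} (G : Graph n) v → coneAdj G v v ≡ false
coneIrrefl G zero = Relation.Binary.PropositionalEquality.refl
coneIrrefl G (suc v) = irrefl G v

cone : ∀ {n} → Graph n → Graph (suc n)
cone G = record { adj = coneAdj G ; sym = coneSym G ; irrefl = coneIrrefl G }

-- Write G' = cone G, with apex `zero` and the vertices of G as `suc i`.
-- Minimal dominating sets of G' fall into two kinds:
--   * apex-free sets  false ∷ D : these are mds of G' exactly when D is an
--     mds of G (the apex is dominated by any non-empty D, and inclusion of
--     apex-free sets is inclusion of their traces on G);
--   * sets containing the apex  true ∷ D : the apex alone dominates G', so
--     such a set is an mds exactly when it is the singleton {apex}, i.e.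
--     D = ⊥.
-- With positive weights, weight w D = 0 iff D = ⊥.  Hence if (t , w)
-- witnesses that G is equidominating, giving the apex weight t witnesses it
-- for G'; conversely a witness for G' restricts to one for G, since only the
-- apex-free half of the correspondence is needed.
module Submission where

open import Defs
open import Data.Nat using (ℕ; NonZero; zero; suc; _+_; ≢-nonZero⁻¹)
open import Data.Nat.Properties using (+-identityʳ; +-cancelˡ-≡; m+n≡0⇒m≡0)
open import Data.Product using (_×_; _,_; proj₁; proj₂)
open import Data.Sum using (inj₁; inj₂)
open import Data.Bool using (true; false)
open import Data.Fin using (Fin; zero; suc)
open import Data.Fin.Subset using (Subset; _⊂_; ⊥; ⁅_⁆; Nonempty)
open import Data.Fin.Subset.Properties
  using (drop-∷-⊂; out⊂; in⊆in; ⊥⊆; Empty-unique; x∈⁅y⁆⇒x≡y; x≢y⇒x∉⁅y⁆)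
open import Data.Vec using ([]; _∷_)
open import Data.Vec.Base using (here; there)
import Data.Empty.Irrelevant as Irrelevant
import Data.Vec.Functional as Vector
open import Function using (_⇔_; mk⇔; Equivalence)
open import Relation.Binary.PropositionalEquality using (_≡_; refl; trans; cong; module ≡-Reasoning) renaming (sym to ≡-sym)
open import Relation.Nullary using (¬_)
open ≡-Reasoning

weight-⊥ : ∀ {n} (w : Fin n → ℕ) → weight w ⊥ ≡ 0
weight-⊥ {zero}  w = refl
weight-⊥ {suc n} w = weight-⊥ (λ i → w (suc i))

weight≡0⇒⊥ : ∀ {n} (w : Fin n → ℕ) → (∀ v → NonZero (w v)) →
  (D : Subset n) → weight w D ≡ 0 → D ≡ ⊥
weight≡0⇒⊥ w pos [] _ = refl
weight≡0⇒⊥ w pos (true ∷ D) e with ≢-nonZero⁻¹ (w zero) {{pos zero}} (m+n≡0⇒m≡0 (w zero) e)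
... | ()
weight≡0⇒⊥ w pos (false ∷ D) e =
  cong (false ∷_) (weight≡0⇒⊥ (λ i → w (suc i)) (λ v → pos (suc v)) D e)

dominating-nonempty : ∀ {m} (G : Graph (suc m)) {D} → Dominating G D → Nonempty D
dominating-nonempty G d with d zero
... | inj₁ zero∈D        = zero , zero∈D
... | inj₂ (u , u∈D , _) = u , u∈D

apex-dominates : ∀ {n} (G : Graph n) D → Dominating (cone G) (true ∷ D)
apex-dominates G D zero    = inj₁ here
apex-dominates G D (suc v) = inj₂ (zero , here , refl)

cone-dominating : ∀ {m} (G : Graph (suc m)) D →
  Dominating G D ⇔ Dominating (cone G) (false ∷ D)
cone-dominating G D = mk⇔ lift lower
  where
  lift : Dominating G D → Dominating (cone G) (false ∷ D)
  lift d zero with dominating-nonempty G d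
  ... | u , u∈D = inj₂ (suc u , there u∈D , refl)
  lift d (suc v) with d v
  ... | inj₁ v∈D            = inj₁ (there v∈D)
  ... | inj₂ (u , u∈D , uv) = inj₂ (suc u , there u∈D , uv)

  lower : Dominating (cone G) (false ∷ D) → Dominating G D
  lower d v with d (suc v)
  ... | inj₁ (there v∈D)              = inj₁ v∈D
  ... | inj₂ (suc u , there u∈D , uv) = inj₂ (u , u∈D , uv)

cone-mds : ∀ {m} (G : Graph (suc m)) D → IsMDS G D ⇔ IsMDS (cone G) (false ∷ D)
cone-mds G D = mk⇔ lift lower
  where
  open Equivalence

  lift : IsMDS G D → IsMDS (cone G) (false ∷ D)
  lift (d , minimal) = to (cone-dominating G D) d , minimal'
    where
    -- A proper subset of an apex-free set is apex-free.
    minimal' : ∀ E → E ⊂ (false ∷ D) → ¬ Dominating (cone G) E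
    minimal' (true ∷ E) (⊆false∷D , _) _ with ⊆false∷D here
    ... | ()
    minimal' (false ∷ E) E⊂D dE = minimal E (drop-∷-⊂ E⊂D) (from (cone-dominating G E) dE)

  lower : IsMDS (cone G) (false ∷ D) → IsMDS G D
  lower (d , minimal) = from (cone-dominating G D) d , minimal'
    where
    minimal' : ∀ E → E ⊂ D → ¬ Dominating G E
    minimal' E E⊂D dE = minimal (false ∷ E) (out⊂ E⊂D) (to (cone-dominating G E) dE)

apex-mds : ∀ {n} (G : Graph n) D → IsMDS (cone G) (true ∷ D) ⇔ D ≡ ⊥
apex-mds G D = mk⇔ only-apex (λ { refl → apex-singleton-mds })
  where
  -- A further vertex x ∈ D could be dropped, leaving {apex} dominating.
  only-apex : IsMDS (cone G) (true ∷ D) → D ≡ ⊥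
  only-apex (_ , minimal) = Empty-unique λ (x , x∈D) →
    minimal ⁅ zero ⁆ (in⊆in ⊥⊆ , suc x , there x∈D , x≢y⇒x∉⁅y⁆ {y = zero} λ ())
            (apex-dominates G ⊥)

  -- A proper subset of {apex} is empty, hence not dominating.
  apex-singleton-mds : IsMDS (cone G) ⁅ zero ⁆
  apex-singleton-mds = apex-dominates G ⊥ , minimal
    where
    minimal : ∀ E → E ⊂ ⁅ zero ⁆ → ¬ Dominating (cone G) E
    minimal E (E⊆apex , y , y∈apex , y∉E) dE with dominating-nonempty (cone G) dE
    ... | x , x∈E with x∈⁅y⁆⇒x≡y zero (E⊆apex x∈E) | x∈⁅y⁆⇒x≡y zero y∈apex
    ... | refl | refl = y∉E x∈E

apex-weight : ∀ {n} t (w : Fin n → ℕ) → (∀ v → NonZero (w v)) → ∀ D →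
  weight (t Vector.∷ w) (true ∷ D) ≡ t ⇔ D ≡ ⊥
apex-weight t w w>0 D = mk⇔
  (λ e → weight≡0⇒⊥ w w>0 D (+-cancelˡ-≡ t (weight w D) 0 (trans e (≡-sym (+-identityʳ t)))))
  (λ { refl → begin
    t + weight w ⊥  ≡⟨ cong (t +_) (weight-⊥ w) ⟩
    t + 0           ≡⟨ +-identityʳ t ⟩
    t               ∎ })

cone-equidominating : ∀ {m} (G : Graph (suc m)) → Equidominating G → Equidominating (cone G)
cone-equidominating G (t , w , t>0 , w>0 , mds⇔t) = t , t Vector.∷ w , t>0 , t∷w>0 , mds'⇔t
  where
  open Equivalence

  t∷w>0 : ∀ v → NonZero ((t Vector.∷ w) v)
  t∷w>0 zero    = t>0
  t∷w>0 (suc i) = w>0 i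

  mds'⇔t : ∀ D → (IsMDS (cone G) D → weight (t Vector.∷ w) D ≡ t)
               × (weight (t Vector.∷ w) D ≡ t → IsMDS (cone G) D)
  mds'⇔t (false ∷ D) = (λ M → proj₁ (mds⇔t D) (from (cone-mds G D) M))
                     , (λ e → to (cone-mds G D) (proj₂ (mds⇔t D) e))
  mds'⇔t (true ∷ D)  = (λ M → from (apex-weight t w w>0 D) (to (apex-mds G D) M))
                     , (λ e → from (apex-mds G D) (to (apex-weight t w w>0 D) e))

restrict-equidominating : ∀ {m} (G : Graph (suc m)) → Equidominating (cone G) → Equidominating G
restrict-equidominating G (t , w , t>0 , w>0 , mds⇔t) =
  t , (λ i → w (suc i)) , t>0 , (λ i → w>0 (suc i)) ,
  λ D → (λ M → proj₁ (mds⇔t (false ∷ D)) (to (cone-mds G D) M))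
      , (λ e → from (cone-mds G D) (proj₂ (mds⇔t (false ∷ D)) e))
  where open Equivalence

lemma8p3 : ∀ (n : ℕ) → .{{_ : NonZero n}} → (G : Graph n) →
    (Equidominating G → Equidominating (cone G)) × (Equidominating (cone G) → Equidominating G)
lemma8p3 zero {{n≢0}} G = Irrelevant.⊥-elim (≢-nonZero⁻¹ 0 {{n≢0}} refl)
lemma8p3 (suc m) G = cone-equidominating G , restrict-equidominating G
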